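{- Let $G=(V,E)$ be a loop-free multigraph. Then a $2$-bounded vertex order of $G$ is dec-min among $2$-bounded orders if and only if it is inc-max among $2$-bounded orders.
   Context: A vertex order is a linear ordering $\sigma=(\sigma_1,\dots,\sigma_n)$ of $V$; the left-degree $\overleftarrow{d}(v)$ of $v=\sigma_i$ is the number of edges (with multiplicity) joining $v$ to $\{\sigma_1,\dots,\sigma_{i-1}\}$. An order is $k$-bounded if every left-degree is at most $k$. A $k$-bounded order is dec-min (among $k$-bounded orders) if its vector of left-degrees sorted in non-increasing order is lexicographically minimal among all $k$-bounded orders, and inc-max if its vector of left-degrees sorted in non-decreasing order is lexicographically maximal among all $k$-bounded orders. -}

module Defs where

open import Data.Nat using (ℕ; zero; suc; _+_; _<_; _≤_)
open import Data.Nat.Properties using (≤-decTotalOrder)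
open import Data.Fin using (Fin) renaming (_<_ to _<ᶠ_)
open import Data.Fin.Properties using (_≟_) renaming (_<?_ to _<ᶠ?_)
open import Data.Fin.Permutation using (Permutation′; _⟨$⟩ʳ_; _⟨$⟩ˡ_)
open import Data.List using (List; []; _∷_; map; allFin; reverse)
open import Data.Nat.ListAction using (sum)
open import Data.List.Relation.Unary.All using (All)
open import Data.Product using (_×_; _,_; proj₁; proj₂)
open import Relation.Binary.PropositionalEquality using (_≡_; _≢_)
open import Relation.Nullary using (Dec; yes; no; _×-dec_)
open import Data.List.Sort ≤-decTotalOrder using (sort)

-- A loop-free multigraph on vertex set Fin n: a list of edges (with
-- repetitions allowed = multiplicities), each joining two distinct vertices.
Edge : ℕ → Set
Edge n = Fin n × Fin n

LoopFree : ∀ {n} → List (Edge n) → Set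
LoopFree E = All (λ e → proj₁ e ≢ proj₂ e) E

-- A vertex order σ: σ ⟨$⟩ʳ i is the vertex in position i (σ_{i+1});
-- the position of vertex v is  pos σ v = σ ⟨$⟩ˡ v.
Order : ℕ → Set
Order n = Permutation′ n

pos : ∀ {n} → Order n → Fin n → Fin n
pos σ v = σ ⟨$⟩ˡ v

𝟙 : ∀ {p} {P : Set p} → Dec P → ℕ
𝟙 (yes _) = 1
𝟙 (no _)  = 0

contrib : ∀ {n} → Order n → Fin n → Edge n → ℕ
contrib σ v (a , b) =
  𝟙 ((a ≟ v) ×-dec (pos σ b <ᶠ? pos σ v)) + 𝟙 ((b ≟ v) ×-dec (pos σ a <ᶠ? pos σ v))

leftDeg : ∀ {n} → List (Edge n) → Order n → Fin n → ℕ
leftDeg E σ v = sum (map (contrib σ v) E)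

Bounded : ∀ {n} → ℕ → List (Edge n) → Order n → Set
Bounded k E σ = ∀ v → leftDeg E σ v ≤ k

degList : ∀ {n} → List (Edge n) → Order n → List ℕ
degList {n} E σ = map (leftDeg E σ) (allFin n)

incVec : ∀ {n} → List (Edge n) → Order n → List ℕ
incVec E σ = sort (degList E σ)

decVec : ∀ {n} → List (Edge n) → Order n → List ℕ
decVec E σ = reverse (sort (degList E σ))

data _≤lex_ : List ℕ → List ℕ → Set where
  []≤  : ∀ {ys} → [] ≤lex ys
  <∷   : ∀ {x y xs ys} → x < y → (x ∷ xs) ≤lex (y ∷ ys)
  ≡∷   : ∀ {x xs ys} → xs ≤lex ys → (x ∷ xs) ≤lex (x ∷ ys)

DecMin : ∀ {n} → ℕ → List (Edge n) → Order n → Set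
DecMin {n} k E σ = Bounded k E σ ×
  ((τ : Order n) → Bounded k E τ → decVec E σ ≤lex decVec E τ)

IncMax : ∀ {n} → ℕ → List (Edge n) → Order n → Set
IncMax {n} k E σ = Bounded k E σ ×
  ((τ : Order n) → Bounded k E τ → incVec E τ ≤lex incVec E σ)

{-# OPTIONS --safe #-}
module Submission where

open import Defs
open import Data.Nat using (ℕ; zero; suc; _+_; _≤_; _<_; z≤n; s≤s)
open import Data.Nat.Properties
  using ( ≤-decTotalOrder; +-0-commutativeMonoid; +-identityʳ; suc-injective; +-suc
        ; +-cancelˡ-≤; +-cancelʳ-≤; +-monoˡ-≤; +-monoʳ-≤; +-cancelˡ-≡; +-cancelʳ-≡
        ; m≤n⇒m<n∨m≡n; module ≤-Reasoning)
open import Data.Fin as Fin using (Fin; punchIn)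
open import Data.Fin.Properties using (_≟_; <-cmp; <-asym; punchInᵢ≢i) renaming (_<?_ to _<ᶠ?_)
open import Data.Fin.Permutation using (_⟨$⟩ʳ_; inverseʳ)
open import Data.List
  using (List; []; _∷_; _++_; _∷ʳ_; replicate; reverse; length; allFin; tabulate)
open import Data.List.Properties
  using (reverse-++; ++-assoc; unfold-reverse; length-map; length-tabulate; map-tabulate)
open import Data.Nat.ListAction using (sum)
open import Data.Nat.ListAction.Properties using (sum-↭)
open import Data.List.Relation.Unary.All using (All; []; _∷_)
open import Data.List.Relation.Unary.All.Properties using (map⁺; tabulate⁺)
open import Data.List.Relation.Unary.Linked using (Linked; _∷_; tail)
open import Data.List.Relation.Binary.Permutation.Propositional.Properties
  using (All-resp-↭; ↭-length)
open import Data.List.Relation.Binary.Permutation.Propositional using (↭-sym)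
open import Data.List.Sort ≤-decTotalOrder using (sort; sort-↭; sort-↗)
open import Algebra.Properties.CommutativeMonoid.Sum +-0-commutativeMonoid
  using (sum-syntax; ∑-distrib-+; sum-remove; sum-cong-≗; sum-replicate-zero)
  renaming (sum to ∑)
open import Data.Product using (_×_; _,_; proj₁; proj₂)
open import Data.Sum using (inj₁; inj₂)
open import Function using (_∘_; id; _⇔_; mk⇔; Equivalence)
open import Function.Construct.Composition using (_⇔-∘_)
open import Relation.Binary using (tri<; tri≈; tri>)
open import Relation.Binary.PropositionalEquality
  using (_≡_; _≢_; refl; sym; trans; cong; cong₂; module ≡-Reasoning)
open import Relation.Nullary using (Dec; yes; no; ¬_; _×-dec_; contradiction)
open import Data.Nat.Solver using (module +-*-Solver)

-- In a 2-bounded order every left-degree is 0, 1 or 2, and each edge is counted in the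
-- left-degree of exactly one endpoint (the later one).  So if a, b, c vertices have
-- left-degree 0, 1, 2, then a + b + c = n and b + 2c = |E|, whence a - c = n - |E| is the
-- same for all 2-bounded orders.  The sorted degree vector 0^a 1^b 2^c is therefore
-- determined by c, and also by a: the non-increasing vector is lexicographically smaller
-- iff c is smaller, and the non-decreasing one lexicographically larger iff a is smaller,
-- which is the same condition.

𝟙-yes : ∀ {P : Set} → P → (p? : Dec P) → 𝟙 p? ≡ 1
𝟙-yes p (yes _) = refl
𝟙-yes p (no ¬p) = contradiction p ¬p

𝟙-no : ∀ {P : Set} → ¬ P → (p? : Dec P) → 𝟙 p? ≡ 0
𝟙-no ¬p (yes p) = contradiction p ¬p
𝟙-no ¬p (no _)  = refl

𝟙-×-dec-yes : ∀ {P Q : Set} → P → (p? : Dec P) (q? : Dec Q) → 𝟙 (p? ×-dec q?) ≡ 𝟙 q?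
𝟙-×-dec-yes p p? (yes q) = 𝟙-yes (p , q) (p? ×-dec yes q)
𝟙-×-dec-yes p p? (no ¬q) = 𝟙-no (¬q ∘ proj₂) (p? ×-dec no ¬q)

𝟙>+𝟙<≡1 : ∀ {n} {x y : Fin n} → x ≢ y → 𝟙 (y <ᶠ? x) + 𝟙 (x <ᶠ? y) ≡ 1
𝟙>+𝟙<≡1 {x = x} {y} x≢y with <-cmp x y
... | tri< x<y _ _ rewrite 𝟙-no (<-asym x<y) (y <ᶠ? x) | 𝟙-yes x<y (x <ᶠ? y) = refl
... | tri≈ _ x≡y _ = contradiction x≡y x≢y
... | tri> _ _ y<x rewrite 𝟙-yes y<x (y <ᶠ? x) | 𝟙-no (<-asym y<x) (x <ᶠ? y) = refl

∑-δ : ∀ {n} (a : Fin n) (f : Fin n → ℕ) → (∀ v → v ≢ a → f v ≡ 0) → ∑ f ≡ f a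
∑-δ {zero}  ()
∑-δ {suc n} a f f≡0 = begin
  ∑ f                             ≡⟨ sum-remove {i = a} f ⟩
  f a + ∑ (λ j → f (punchIn a j)) ≡⟨ cong (f a +_) ∑-rest≡0 ⟩
  f a + 0                         ≡⟨ +-identityʳ (f a) ⟩
  f a                             ∎
  where
  open ≡-Reasoning
  ∑-rest≡0 : ∑ (λ j → f (punchIn a j)) ≡ 0
  ∑-rest≡0 = trans (sum-cong-≗ (λ j → f≡0 (punchIn a j) (punchInᵢ≢i a j))) (sum-replicate-zero n)

∑-𝟙-at : ∀ {n} {P : Fin n → Set} (a : Fin n) (P? : ∀ v → Dec (P v)) →
         ∑[ v < n ] 𝟙 ((a ≟ v) ×-dec P? v) ≡ 𝟙 (P? a)
∑-𝟙-at a P? =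
  trans (∑-δ a _ (λ v v≢a → 𝟙-no (v≢a ∘ sym ∘ proj₁) _)) (𝟙-×-dec-yes refl (a ≟ a) (P? a))

pos-injective : ∀ {n} (σ : Order n) {u v : Fin n} → pos σ u ≡ pos σ v → u ≡ v
pos-injective σ eq =
  trans (sym (inverseʳ σ)) (trans (cong (σ ⟨$⟩ʳ_) eq) (inverseʳ σ))

∑-contrib≡1 : ∀ {n} (σ : Order n) {a b : Fin n} → a ≢ b → ∑[ v < n ] contrib σ v (a , b) ≡ 1
∑-contrib≡1 {n} σ {a} {b} a≢b = begin
  ∑[ v < n ] (endAfter a b v + endAfter b a v)         ≡⟨ ∑-distrib-+ (endAfter a b) (endAfter b a) ⟩
  ∑ (endAfter a b) + ∑ (endAfter b a)                  ≡⟨ cong₂ _+_ (∑-𝟙-at a _) (∑-𝟙-at b _) ⟩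
  𝟙 (pos σ b <ᶠ? pos σ a) + 𝟙 (pos σ a <ᶠ? pos σ b)   ≡⟨ 𝟙>+𝟙<≡1 (a≢b ∘ pos-injective σ) ⟩
  1                                                    ∎
  where
  open ≡-Reasoning
  endAfter : Fin n → Fin n → Fin n → ℕ
  endAfter x y v = 𝟙 ((x ≟ v) ×-dec (pos σ y <ᶠ? pos σ v))

∑-leftDeg≡length : ∀ {n} (σ : Order n) {E : List (Edge n)} → LoopFree E →
                   ∑[ v < n ] leftDeg E σ v ≡ length E
∑-leftDeg≡length {n} σ []                       = sum-replicate-zero n
∑-leftDeg≡length {n} σ {e ∷ E} (a≢b ∷ loopFree) =
  trans (∑-distrib-+ (λ v → contrib σ v e) (leftDeg E σ))
        (cong₂ _+_ (∑-contrib≡1 σ a≢b) (∑-leftDeg≡length σ loopFree))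

ascending : ℕ → ℕ → ℕ → List ℕ
ascending a b c = replicate a 0 ++ replicate b 1 ++ replicate c 2

descending : ℕ → ℕ → ℕ → List ℕ
descending a b c = replicate c 2 ++ replicate b 1 ++ replicate a 0

length-ascending : ∀ a b c → length (ascending a b c) ≡ a + b + c
length-ascending (suc a) b       c       = cong suc (length-ascending a b c)
length-ascending zero    (suc b) c       = cong suc (length-ascending zero b c)
length-ascending zero    zero    (suc c) = cong suc (length-ascending zero zero c)
length-ascending zero    zero    zero    = refl

sum-ascending : ∀ a b c → sum (ascending a b c) ≡ b + (c + c)
sum-ascending (suc a) b       c       = sum-ascending a b c
sum-ascending zero    (suc b) c       = cong suc (sum-ascending zero b c)
sum-ascending zero    zero    (suc c) =
  cong suc (trans (cong suc (sum-ascending zero zero c)) (sym (+-suc c c)))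
sum-ascending zero    zero    zero    = refl

replicate-∷ʳ : ∀ k (x : ℕ) → replicate k x ∷ʳ x ≡ x ∷ replicate k x
replicate-∷ʳ zero    x = refl
replicate-∷ʳ (suc k) x = cong (x ∷_) (replicate-∷ʳ k x)

reverse-replicate : ∀ k (x : ℕ) → reverse (replicate k x) ≡ replicate k x
reverse-replicate zero    x = refl
reverse-replicate (suc k) x = begin
  reverse (x ∷ replicate k x)  ≡⟨ unfold-reverse x (replicate k x) ⟩
  reverse (replicate k x) ∷ʳ x ≡⟨ cong (_∷ʳ x) (reverse-replicate k x) ⟩
  replicate k x ∷ʳ x           ≡⟨ replicate-∷ʳ k x ⟩
  x ∷ replicate k x            ∎
  where open ≡-Reasoning

reverse-ascending : ∀ a b c → reverse (ascending a b c) ≡ descending a b c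
reverse-ascending a b c = begin
  reverse (zeros ++ ones ++ twos)               ≡⟨ reverse-++ zeros (ones ++ twos) ⟩
  reverse (ones ++ twos) ++ reverse zeros       ≡⟨ cong (_++ reverse zeros) (reverse-++ ones twos) ⟩
  (reverse twos ++ reverse ones) ++ reverse zeros
    ≡⟨ cong₂ _++_ (cong₂ _++_ (reverse-replicate c 2) (reverse-replicate b 1)) (reverse-replicate a 0) ⟩
  (twos ++ ones) ++ zeros                       ≡⟨ ++-assoc twos ones zeros ⟩
  twos ++ ones ++ zeros                         ∎
  where
  open ≡-Reasoning
  zeros = replicate a 0
  ones  = replicate b 1
  twos  = replicate c 2

data Sorted012 : List ℕ → Set where
  sorted012 : ∀ a b c → Sorted012 (ascending a b c)

∷-sorted012 : ∀ {x xs} → x ≤ 2 → Sorted012 xs → Linked _≤_ (x ∷ xs) → Sorted012 (x ∷ xs)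
∷-sorted012 {0} _ (sorted012 a       b       c) _ = sorted012 (suc a) b c
∷-sorted012 {1} _ (sorted012 zero    b       c) _ = sorted012 zero (suc b) c
∷-sorted012 {1} _ (sorted012 (suc a) b       c) (() ∷ _)
∷-sorted012 {2} _ (sorted012 zero    zero    c) _ = sorted012 zero zero (suc c)
∷-sorted012 {2} _ (sorted012 zero    (suc b) c) (s≤s () ∷ _)
∷-sorted012 {2} _ (sorted012 (suc a) b       c) (() ∷ _)
∷-sorted012 {suc (suc (suc x))} (s≤s (s≤s ())) _ _

sorted⇒sorted012 : ∀ {xs} → Linked _≤_ xs → All (_≤ 2) xs → Sorted012 xs
sorted⇒sorted012 _      []           = sorted012 0 0 0
sorted⇒sorted012 sorted (x≤2 ∷ xs≤2) = ∷-sorted012 x≤2 (sorted⇒sorted012 (tail sorted) xs≤2) sorted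

≤lex-reflexive : ∀ {xs ys} → xs ≡ ys → xs ≤lex ys
≤lex-reflexive {[]}     refl = []≤
≤lex-reflexive {x ∷ xs} refl = ≡∷ (≤lex-reflexive refl)

descending-<lex : ∀ {a b c a' b' c'} → c < c' → descending a b c ≤lex descending a' b' c'
descending-<lex {a} {b} {suc c} {a'} {b'} {suc c'} (s≤s c<c') =
  ≡∷ (descending-<lex {a} {b} {c} {a'} {b'} {c'} c<c')
descending-<lex {b = suc b} {c = zero} {c' = suc c'} _ = <∷ (s≤s (s≤s z≤n))
descending-<lex {a = suc a} {b = zero} {c = zero} {c' = suc c'} _ = <∷ (s≤s z≤n)
descending-<lex {a = zero} {b = zero} {c = zero} {c' = suc c'} _ = []≤

≤lex-descending⇒ : ∀ {a b c a' b' c'} → descending a b c ≤lex descending a' b' c' → c ≤ c'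
≤lex-descending⇒ {c = zero} _ = z≤n
≤lex-descending⇒ {c = suc c} {c' = suc c'} (<∷ (s≤s (s≤s ())))
≤lex-descending⇒ {a} {b} {suc c} {a'} {b'} {suc c'} (≡∷ h) =
  s≤s (≤lex-descending⇒ {a} {b} {c} {a'} {b'} {c'} h)
≤lex-descending⇒ {c = suc c} {b' = suc b'} {c' = zero} (<∷ (s≤s ()))
≤lex-descending⇒ {c = suc c} {a' = suc a'} {b' = zero} {c' = zero} (<∷ ())
≤lex-descending⇒ {c = suc c} {a' = zero} {b' = zero} {c' = zero} ()

ascending-<lex : ∀ {a b c a' b' c'} → a + b + c ≡ a' + b' + c' → a < a' →
                 ascending a' b' c' ≤lex ascending a b c
ascending-<lex {a = suc a} {a' = suc a'} eq (s≤s a<a') = ≡∷ (ascending-<lex (suc-injective eq) a<a')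
ascending-<lex {a = zero} {b = suc b} {a' = suc a'} _ _ = <∷ (s≤s z≤n)
ascending-<lex {a = zero} {b = zero} {c = suc c} {a' = suc a'} _ _ = <∷ (s≤s z≤n)
ascending-<lex {a = zero} {b = zero} {c = zero} {a' = suc a'} () _

≥lex-ascending⇒ : ∀ {a b c a' b' c'} → a + b + c ≡ a' + b' + c' →
                  ascending a' b' c' ≤lex ascending a b c → a ≤ a'
≥lex-ascending⇒ {a = zero} _ _ = z≤n
≥lex-ascending⇒ {a = suc a} {a' = suc a'} eq (≡∷ h) = s≤s (≥lex-ascending⇒ (suc-injective eq) h)
≥lex-ascending⇒ {a = suc a} {a' = suc a'} eq (<∷ ())
≥lex-ascending⇒ {a = suc a} {a' = zero} {b' = suc b'} _ (<∷ ())
≥lex-ascending⇒ {a = suc a} {a' = zero} {b' = zero} {c' = suc c'} _ (<∷ ())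
≥lex-ascending⇒ {a = suc a} {a' = zero} {b' = zero} {c' = zero} () _

zeros+sum≡length+twos : ∀ a b c → a + (b + (c + c)) ≡ a + b + c + c
zeros+sum≡length+twos = solve 3 (λ a b c → a :+ (b :+ (c :+ c)) := a :+ b :+ c :+ c) refl
  where open +-*-Solver

module EqualLengthAndSum {a b c a' b' c' : ℕ}
         (length≡ : a + b + c ≡ a' + b' + c') (sum≡ : b + (c + c) ≡ b' + (c' + c')) where

  private
    n m : ℕ
    n = a' + b' + c'
    m = b' + (c' + c')

    excess : a + m ≡ n + c
    excess = begin
      a + m                  ≡⟨ cong (a +_) sum≡ ⟨
      a + (b + (c + c))      ≡⟨ zeros+sum≡length+twos a b c ⟩
      a + b + c + c          ≡⟨ cong (_+ c) length≡ ⟩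
      n + c                  ∎
      where open ≡-Reasoning

    excess′ : a' + m ≡ n + c'
    excess′ = zeros+sum≡length+twos a' b' c'

    twos≡⇒≡ : c ≡ c' → (a , b , c) ≡ (a' , b' , c')
    twos≡⇒≡ c≡c' = cong₂ _,_ a≡a' (cong₂ _,_ b≡b' c≡c')
      where
      a≡a' : a ≡ a'
      a≡a' = +-cancelʳ-≡ m a a' (trans excess (trans (cong (n +_) c≡c') (sym excess′)))
      b≡b' : b ≡ b'
      b≡b' = +-cancelʳ-≡ (c + c) b b' (trans sum≡ (cong (λ z → b' + (z + z)) (sym c≡c')))

    zeros≡⇒twos≡ : a ≡ a' → c ≡ c'
    zeros≡⇒twos≡ a≡a' = +-cancelˡ-≡ n c c' (trans (sym excess) (trans (cong (_+ m) a≡a') excess′))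

  twos≤⇔zeros≤ : c ≤ c' ⇔ a ≤ a'
  twos≤⇔zeros≤ = mk⇔ twos≤⇒zeros≤ zeros≤⇒twos≤
    where
    open ≤-Reasoning
    twos≤⇒zeros≤ : c ≤ c' → a ≤ a'
    twos≤⇒zeros≤ c≤c' = +-cancelʳ-≤ m a a' (begin
      a + m  ≡⟨ excess ⟩
      n + c  ≤⟨ +-monoʳ-≤ n c≤c' ⟩
      n + c' ≡⟨ excess′ ⟨
      a' + m ∎)
    zeros≤⇒twos≤ : a ≤ a' → c ≤ c'
    zeros≤⇒twos≤ a≤a' = +-cancelˡ-≤ n c c' (begin
      n + c  ≡⟨ excess ⟨
      a + m  ≤⟨ +-monoˡ-≤ m a≤a' ⟩
      a' + m ≡⟨ excess′ ⟩
      n + c' ∎)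

  ≤lex-descending⇔twos≤ : descending a b c ≤lex descending a' b' c' ⇔ c ≤ c'
  ≤lex-descending⇔twos≤ = mk⇔ (≤lex-descending⇒ {a} {b} {c} {a'} {b'} {c'}) twos≤⇒≤lex
    where
    twos≤⇒≤lex : c ≤ c' → descending a b c ≤lex descending a' b' c'
    twos≤⇒≤lex c≤c' with m≤n⇒m<n∨m≡n c≤c'
    ... | inj₁ c<c' = descending-<lex {a} {b} {c} {a'} {b'} {c'} c<c'
    ... | inj₂ c≡c' = ≤lex-reflexive (cong (λ (x , y , z) → descending x y z) (twos≡⇒≡ c≡c'))

  zeros≤⇔≥lex-ascending : a ≤ a' ⇔ ascending a' b' c' ≤lex ascending a b c
  zeros≤⇔≥lex-ascending = mk⇔ zeros≤⇒≥lex (≥lex-ascending⇒ length≡)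
    where
    zeros≤⇒≥lex : a ≤ a' → ascending a' b' c' ≤lex ascending a b c
    zeros≤⇒≥lex a≤a' with m≤n⇒m<n∨m≡n a≤a'
    ... | inj₁ a<a' = ascending-<lex length≡ a<a'
    ... | inj₂ a≡a' =
      ≤lex-reflexive (cong (λ (x , y , z) → ascending x y z) (sym (twos≡⇒≡ (zeros≡⇒twos≡ a≡a'))))

reverse-≤lex⇔≥lex : ∀ {xs ys} → Sorted012 xs → Sorted012 ys →
                    length xs ≡ length ys → sum xs ≡ sum ys →
                    reverse xs ≤lex reverse ys ⇔ ys ≤lex xs
reverse-≤lex⇔≥lex (sorted012 a b c) (sorted012 a' b' c') length≡ sum≡
  rewrite reverse-ascending a b c | reverse-ascending a' b' c' =
  zeros≤⇔≥lex-ascending ⇔-∘ (twos≤⇔zeros≤ ⇔-∘ ≤lex-descending⇔twos≤)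
  where
  open EqualLengthAndSum {a} {b} {c} {a'} {b'} {c'}
    (trans (sym (length-ascending a b c)) (trans length≡ (length-ascending a' b' c')))
    (trans (sym (sum-ascending a b c)) (trans sum≡ (sum-ascending a' b' c')))

sum-tabulate : ∀ {n} (f : Fin n → ℕ) → sum (tabulate f) ≡ ∑ f
sum-tabulate {zero}  f = refl
sum-tabulate {suc n} f = cong (f Fin.zero +_) (sum-tabulate (f ∘ Fin.suc))

module _ {n} (E : List (Edge n)) (σ : Order n) where

  incVec-sorted012 : Bounded 2 E σ → Sorted012 (incVec E σ)
  incVec-sorted012 bounded = sorted⇒sorted012 (sort-↗ (degList E σ))
    (All-resp-↭ (↭-sym (sort-↭ (degList E σ))) (map⁺ (tabulate⁺ bounded)))

  length-incVec : length (incVec E σ) ≡ n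
  length-incVec = begin
    length (sort (degList E σ)) ≡⟨ ↭-length (sort-↭ (degList E σ)) ⟩
    length (degList E σ)        ≡⟨ length-map (leftDeg E σ) (allFin n) ⟩
    length (allFin n)           ≡⟨ length-tabulate id ⟩
    n                           ∎
    where open ≡-Reasoning

  sum-incVec : LoopFree E → sum (incVec E σ) ≡ length E
  sum-incVec loopFree = begin
    sum (sort (degList E σ))       ≡⟨ sum-↭ (sort-↭ (degList E σ)) ⟩
    sum (degList E σ)              ≡⟨ cong sum (map-tabulate id (leftDeg E σ)) ⟩
    sum (tabulate (leftDeg E σ))   ≡⟨ sum-tabulate (leftDeg E σ) ⟩
    ∑[ v < n ] leftDeg E σ v       ≡⟨ ∑-leftDeg≡length σ loopFree ⟩
    length E                       ∎
    where open ≡-Reasoning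

decVec≤lex⇔incVec≥lex : ∀ {n} (E : List (Edge n)) → LoopFree E → (σ τ : Order n) →
                        Bounded 2 E σ → Bounded 2 E τ →
                        decVec E σ ≤lex decVec E τ ⇔ incVec E τ ≤lex incVec E σ
decVec≤lex⇔incVec≥lex E loopFree σ τ bσ bτ =
  reverse-≤lex⇔≥lex (incVec-sorted012 E σ bσ) (incVec-sorted012 E τ bτ)
    (trans (length-incVec E σ) (sym (length-incVec E τ)))
    (trans (sum-incVec E σ loopFree) (sym (sum-incVec E τ loopFree)))

lemma1 : (n : ℕ) (E : List (Edge n)) → LoopFree E →
    (σ : Order n) → Bounded 2 E σ →
    (DecMin 2 E σ → IncMax 2 E σ) × (IncMax 2 E σ → DecMin 2 E σ)
lemma1 n E loopFree σ bσ =
    (λ (_ , decMin) → bσ , λ τ bτ → Equivalence.to   (compare τ bτ) (decMin τ bτ))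
  , (λ (_ , incMax) → bσ , λ τ bτ → Equivalence.from (compare τ bτ) (incMax τ bτ))
  where
  compare : (τ : Order n) → Bounded 2 E τ → decVec E σ ≤lex decVec E τ ⇔ incVec E τ ≤lex incVec E σ
  compare τ bτ = decVec≤lex⇔incVec≥lex E loopFree σ τ bσ bτ
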